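{- For any formulas $\varphi(X)$ and $\psi(X)$ (possibly with other parameters), $\mathrm{CM}+\mathrm{GWO}$ proves \[\forall X\,\bigl(\forall Y\prec X\,(\varphi(Y)\lor\psi(Y))\rightarrow(\forall Y\prec X\,\varphi(Y)\lor\exists Y\prec X\,\psi(Y))\bigr),\] and likewise the same statement with every $\prec$ replaced by $\preceq$.
   Context: $Y\preceq X$ abbreviates $Y\prec X\lor Y=X$; $\forall Y\prec X\,\chi$ abbreviates $\forall Y(Y\prec X\rightarrow\chi)$ and $\exists Y\prec X\,\chi$ abbreviates $\exists Y(Y\prec X\land\chi)$. $\mathrm{CM}$ is the intuitionistic three-sorted theory (number variables; second-order variables $X,Y,Z,\dots$ for sets of numbers; third-order variables $\mathbf{X},\dots$; symbols $0$, successor, $+$, $\cdot$, number equality, $\in_1$, $\in_2$, binary relation $\prec$ on second-order objects; $X=Y$ means $\forall n(n\in_1X\leftrightarrow n\in_1Y)$) with axioms: $\mathrm{PA}$ without induction; induction for all formulas; dependent choice $\forall n\,\forall X\,\exists Y\,\varphi(n,X,Y)\rightarrow\forall X\,\exists Z((Z)_0=X\land\forall n\,\varphi(n,(Z)_n,(Z)_{n+1}))$ where $(Z)_n=\{m:\langle n,m\rangle\in_1Z\}$, $\langle m,n\rangle=(m+n)(m+n+1)/2+m$; decidable comprehension $\forall n(\varphi(n)\lor\neg\varphi(n))\rightarrow\exists X\,\forall n(n\in_1X\leftrightarrow\varphi(n))$ and $\forall X(\varphi(X)\lor\neg\varphi(X))\rightarrow\exists\mathbf{X}\,\forall X(X\in_2\mathbf{X}\leftrightarrow\varphi(X))$;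 decidability of $n=m$, $n\in_1X$, $X\in_2\mathbf{X}$, $X\prec Y$; numerical omniscience $\forall n(\varphi(n)\lor\psi(n))\rightarrow(\forall n\,\varphi(n)\lor\exists n\,\psi(n))$; extensionality of $\in_2$ and $\prec$ w.r.t. $=$. $\mathrm{GWO}$: (W1) $\prec$ is a linear ordering; (W2) $\forall X(\forall Y(Y\prec X\rightarrow\varphi(Y))\rightarrow\varphi(X))\rightarrow\forall X\,\varphi(X)$ for every formula; (W3) $\forall X\,\exists Z\,\forall Y(Y\prec X\rightarrow\exists n\,Y=(Z)_n)$. -}

module Defs where

open import Data.List using (List; []; _∷_; map)
open import Data.Product using (_×_)

data Sort : Set where
  num set cls : Sort      -- numbers, sets of numbers (2nd order), 3rd order

infixl 5 _▷_
data Ctx : Set where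
  ε   : Ctx
  _▷_ : Ctx → Sort → Ctx

infix 4 _∋_
data _∋_ : Ctx → Sort → Set where
  here  : ∀ {Γ s} → (Γ ▷ s) ∋ s
  there : ∀ {Γ s t} → Γ ∋ s → (Γ ▷ t) ∋ s

infixl 10 _`·_
infixl 9 _`+_
data Tm (Γ : Ctx) : Sort → Set where
  var  : ∀ {s} → Γ ∋ s → Tm Γ s
  `0   : Tm Γ num
  `S   : Tm Γ num → Tm Γ num
  _`+_ : Tm Γ num → Tm Γ num → Tm Γ num
  _`·_ : Tm Γ num → Tm Γ num → Tm Γ num

infix 8 _≐_ _∈₁_ _∈₂_ _≺_
infixr 6 _∧'_
infixr 5 _∨'_
infixr 4 _⇒_
data Fm (Γ : Ctx) : Set where
  ⊥'   : Fm Γ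
  _∧'_ : Fm Γ → Fm Γ → Fm Γ
  _∨'_ : Fm Γ → Fm Γ → Fm Γ
  _⇒_  : Fm Γ → Fm Γ → Fm Γ
  ∀'   : (s : Sort) → Fm (Γ ▷ s) → Fm Γ
  ∃'   : (s : Sort) → Fm (Γ ▷ s) → Fm Γ
  _≐_  : Tm Γ num → Tm Γ num → Fm Γ
  _∈₁_ : Tm Γ num → Tm Γ set → Fm Γ
  _∈₂_ : Tm Γ set → Tm Γ cls → Fm Γ
  _≺_  : Tm Γ set → Tm Γ set → Fm Γ

Ren : Ctx → Ctx → Set
Ren Γ Δ = ∀ {s} → Γ ∋ s → Δ ∋ s

liftR : ∀ {Γ Δ t} → Ren Γ Δ → Ren (Γ ▷ t) (Δ ▷ t)
liftR ρ here      = here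
liftR ρ (there x) = there (ρ x)

renTm : ∀ {Γ Δ s} → Ren Γ Δ → Tm Γ s → Tm Δ s
renTm ρ (var x)  = var (ρ x)
renTm ρ `0       = `0
renTm ρ (`S t)   = `S (renTm ρ t)
renTm ρ (t `+ u) = renTm ρ t `+ renTm ρ u
renTm ρ (t `· u) = renTm ρ t `· renTm ρ u

renFm : ∀ {Γ Δ} → Ren Γ Δ → Fm Γ → Fm Δ
renFm ρ ⊥'       = ⊥'
renFm ρ (φ ∧' ψ) = renFm ρ φ ∧' renFm ρ ψ
renFm ρ (φ ∨' ψ) = renFm ρ φ ∨' renFm ρ ψ
renFm ρ (φ ⇒ ψ)  = renFm ρ φ ⇒ renFm ρ ψ
renFm ρ (∀' s φ) = ∀' s (renFm (liftR ρ) φ)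
renFm ρ (∃' s φ) = ∃' s (renFm (liftR ρ) φ)
renFm ρ (t ≐ u)  = renTm ρ t ≐ renTm ρ u
renFm ρ (t ∈₁ u) = renTm ρ t ∈₁ renTm ρ u
renFm ρ (t ∈₂ u) = renTm ρ t ∈₂ renTm ρ u
renFm ρ (t ≺ u)  = renTm ρ t ≺ renTm ρ u

Sub : Ctx → Ctx → Set
Sub Γ Δ = ∀ {s} → Γ ∋ s → Tm Δ s

liftS : ∀ {Γ Δ t} → Sub Γ Δ → Sub (Γ ▷ t) (Δ ▷ t)
liftS σ here      = var here
liftS σ (there x) = renTm there (σ x)

subTm : ∀ {Γ Δ s} → Sub Γ Δ → Tm Γ s → Tm Δ s
subTm σ (var x)  = σ x
subTm σ `0       = `0
subTm σ (`S t)   = `S (subTm σ t)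
subTm σ (t `+ u) = subTm σ t `+ subTm σ u
subTm σ (t `· u) = subTm σ t `· subTm σ u

subFm : ∀ {Γ Δ} → Sub Γ Δ → Fm Γ → Fm Δ
subFm σ ⊥'       = ⊥'
subFm σ (φ ∧' ψ) = subFm σ φ ∧' subFm σ ψ
subFm σ (φ ∨' ψ) = subFm σ φ ∨' subFm σ ψ
subFm σ (φ ⇒ ψ)  = subFm σ φ ⇒ subFm σ ψ
subFm σ (∀' s φ) = ∀' s (subFm (liftS σ) φ)
subFm σ (∃' s φ) = ∃' s (subFm (liftS σ) φ)
subFm σ (t ≐ u)  = subTm σ t ≐ subTm σ u
subFm σ (t ∈₁ u) = subTm σ t ∈₁ subTm σ u
subFm σ (t ∈₂ u) = subTm σ t ∈₂ subTm σ u
subFm σ (t ≺ u)  = subTm σ t ≺ subTm σ u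

single : ∀ {Γ s} → Tm Γ s → Sub (Γ ▷ s) Γ
single t here      = t
single t (there x) = var x

_[_] : ∀ {Γ s} → Fm (Γ ▷ s) → Tm Γ s → Fm Γ
φ [ t ] = subFm (single t) φ

wk : ∀ {Γ s} → Fm Γ → Fm (Γ ▷ s)
wk = renFm there

wkT : ∀ {Γ s t} → Tm Γ t → Tm (Γ ▷ s) t
wkT = renTm there

sucSub : ∀ {Γ} → Sub (Γ ▷ num) (Γ ▷ num)
sucSub here      = `S (var here)
sucSub (there x) = var (there x)

v0 : ∀ {Γ s} → Tm (Γ ▷ s) s
v0 = var here
v1 : ∀ {Γ s t} → Tm (Γ ▷ s ▷ t) s
v1 = var (there here)
v2 : ∀ {Γ s t u} → Tm (Γ ▷ s ▷ t ▷ u) s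
v2 = var (there (there here))
v3 : ∀ {Γ s t u w} → Tm (Γ ▷ s ▷ t ▷ u ▷ w) s
v3 = var (there (there (there here)))
v4 : ∀ {Γ s t u w z} → Tm (Γ ▷ s ▷ t ▷ u ▷ w ▷ z) s
v4 = var (there (there (there (there here))))

¬' : ∀ {Γ} → Fm Γ → Fm Γ
¬' φ = φ ⇒ ⊥'

infix 3 _⇔_
_⇔_ : ∀ {Γ} → Fm Γ → Fm Γ → Fm Γ
φ ⇔ ψ = (φ ⇒ ψ) ∧' (ψ ⇒ φ)

infix 8 _≡ˢ_
_≡ˢ_ : ∀ {Γ} → Tm Γ set → Tm Γ set → Fm Γ
X ≡ˢ Y = ∀' num ((v0 ∈₁ wkT X) ⇔ (v0 ∈₁ wkT Y))

infix 8 _⪯_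
_⪯_ : ∀ {Γ} → Tm Γ set → Tm Γ set → Fm Γ
Y ⪯ X = (Y ≺ X) ∨' (Y ≡ˢ X)

-- k = ⟨m,n⟩ = (m+n)(m+n+1)/2 + m, expressed without division:
-- 2k = (m+n)(m+n+1) + 2m
IsPair : ∀ {Γ} → Tm Γ num → Tm Γ num → Tm Γ num → Fm Γ
IsPair k m n = (k `+ k) ≐ ((m `+ n) `· (m `+ n `+ `S `0)) `+ (m `+ m)

PairIn : ∀ {Γ} → Tm Γ num → Tm Γ num → Tm Γ set → Fm Γ
PairIn m n Z = ∃' num (IsPair v0 (wkT m) (wkT n) ∧' (v0 ∈₁ wkT Z))

-- Y = (Z)_n, where (Z)_n = {m : ⟨n,m⟩ ∈₁ Z}
IsComp : ∀ {Γ} → Tm Γ set → Tm Γ set → Tm Γ num → Fm Γ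
IsComp Y Z n = ∀' num ((v0 ∈₁ wkT Y) ⇔ PairIn (wkT n) v0 (wkT Z))

-- renaming for dependent choice:  (Γ, n, X, Y) into (Γ, X₀, Z, n, U, V)
dcRen : ∀ {Γ} → Ren (Γ ▷ num ▷ set ▷ set) (Γ ▷ set ▷ set ▷ num ▷ set ▷ set)
dcRen = liftR (liftR (liftR (λ x → there (there x))))

data Ax : (Γ : Ctx) → Fm Γ → Set where
  pa-S≢0   : ∀ {Γ} → Ax Γ (∀' num (¬' (`S v0 ≐ `0)))
  pa-Sinj  : ∀ {Γ} → Ax Γ (∀' num (∀' num (`S v1 ≐ `S v0 ⇒ v1 ≐ v0)))
  pa-+0    : ∀ {Γ} → Ax Γ (∀' num (v0 `+ `0 ≐ v0))
  pa-+S    : ∀ {Γ} → Ax Γ (∀' num (∀' num (v1 `+ `S v0 ≐ `S (v1 `+ v0))))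
  pa-·0    : ∀ {Γ} → Ax Γ (∀' num (v0 `· `0 ≐ `0))
  pa-·S    : ∀ {Γ} → Ax Γ (∀' num (∀' num (v1 `· `S v0 ≐ v1 `· v0 `+ v1)))
  induction : ∀ {Γ} (φ : Fm (Γ ▷ num)) →
    Ax Γ ((φ [ `0 ] ∧' ∀' num (φ ⇒ subFm sucSub φ)) ⇒ ∀' num φ)
  depChoice : ∀ {Γ} (φ : Fm (Γ ▷ num ▷ set ▷ set)) →
    Ax Γ (∀' num (∀' set (∃' set φ)) ⇒
          ∀' set (∃' set (IsComp v1 v0 `0 ∧'
            ∀' num (∀' set (∀' set
              ((IsComp v1 v3 v2 ∧' IsComp v0 v3 (`S v2)) ⇒ renFm dcRen φ))))))
  comp₂ : ∀ {Γ} (φ : Fm (Γ ▷ num)) →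
    Ax Γ (∀' num (φ ∨' ¬' φ) ⇒
          ∃' set (∀' num ((v0 ∈₁ v1) ⇔ renFm (liftR there) φ)))
  comp₃ : ∀ {Γ} (φ : Fm (Γ ▷ set)) →
    Ax Γ (∀' set (φ ∨' ¬' φ) ⇒
          ∃' cls (∀' set ((v0 ∈₂ v1) ⇔ renFm (liftR there) φ)))
  dec-≐  : ∀ {Γ} → Ax Γ (∀' num (∀' num ((v1 ≐ v0) ∨' ¬' (v1 ≐ v0))))
  dec-∈₁ : ∀ {Γ} → Ax Γ (∀' num (∀' set ((v1 ∈₁ v0) ∨' ¬' (v1 ∈₁ v0))))
  dec-∈₂ : ∀ {Γ} → Ax Γ (∀' set (∀' cls ((v1 ∈₂ v0) ∨' ¬' (v1 ∈₂ v0))))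
  dec-≺  : ∀ {Γ} → Ax Γ (∀' set (∀' set ((v1 ≺ v0) ∨' ¬' (v1 ≺ v0))))
  omniscience : ∀ {Γ} (φ ψ : Fm (Γ ▷ num)) →
    Ax Γ (∀' num (φ ∨' ψ) ⇒ (∀' num φ ∨' ∃' num ψ))
  ext-∈₂ : ∀ {Γ} → Ax Γ (∀' set (∀' set (∀' cls
             ((v2 ≡ˢ v1) ⇒ (v2 ∈₂ v0) ⇒ (v1 ∈₂ v0)))))
  ext-≺  : ∀ {Γ} → Ax Γ (∀' set (∀' set (∀' set
             ((v2 ≡ˢ v1) ⇒ (((v2 ≺ v0) ⇒ (v1 ≺ v0)) ∧' ((v0 ≺ v2) ⇒ (v0 ≺ v1)))))))
  w1-irrefl : ∀ {Γ} → Ax Γ (∀' set (¬' (v0 ≺ v0)))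
  w1-trans  : ∀ {Γ} → Ax Γ (∀' set (∀' set (∀' set ((v2 ≺ v1) ⇒ (v1 ≺ v0) ⇒ (v2 ≺ v0)))))
  w1-linear : ∀ {Γ} → Ax Γ (∀' set (∀' set ((v1 ≺ v0) ∨' (v1 ≡ˢ v0) ∨' (v0 ≺ v1))))
  w2 : ∀ {Γ} (φ : Fm (Γ ▷ set)) →
    Ax Γ (∀' set (∀' set ((v0 ≺ v1) ⇒ renFm (liftR there) φ) ⇒ φ) ⇒ ∀' set φ)
  w3 : ∀ {Γ} → Ax Γ (∀' set (∃' set (∀' set ((v0 ≺ v2) ⇒ ∃' num (IsComp v1 v2 v0)))))

infix 4 _∈ʰ_
data _∈ʰ_ {Γ : Ctx} (φ : Fm Γ) : List (Fm Γ) → Set where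
  hd : ∀ {Δ} → φ ∈ʰ (φ ∷ Δ)
  tl : ∀ {ψ Δ} → φ ∈ʰ Δ → φ ∈ʰ (ψ ∷ Δ)

infix 1 _∣_⊢_
data _∣_⊢_ : (Γ : Ctx) → List (Fm Γ) → Fm Γ → Set where
  hyp  : ∀ {Γ Δ φ} → φ ∈ʰ Δ → Γ ∣ Δ ⊢ φ
  ax   : ∀ {Γ Δ φ} → Ax Γ φ → Γ ∣ Δ ⊢ φ
  ⊥E   : ∀ {Γ Δ φ} → Γ ∣ Δ ⊢ ⊥' → Γ ∣ Δ ⊢ φ
  ∧I   : ∀ {Γ Δ φ ψ} → Γ ∣ Δ ⊢ φ → Γ ∣ Δ ⊢ ψ → Γ ∣ Δ ⊢ φ ∧' ψ
  ∧E₁  : ∀ {Γ Δ φ ψ} → Γ ∣ Δ ⊢ φ ∧' ψ → Γ ∣ Δ ⊢ φ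
  ∧E₂  : ∀ {Γ Δ φ ψ} → Γ ∣ Δ ⊢ φ ∧' ψ → Γ ∣ Δ ⊢ ψ
  ∨I₁  : ∀ {Γ Δ φ ψ} → Γ ∣ Δ ⊢ φ → Γ ∣ Δ ⊢ φ ∨' ψ
  ∨I₂  : ∀ {Γ Δ φ ψ} → Γ ∣ Δ ⊢ ψ → Γ ∣ Δ ⊢ φ ∨' ψ
  ∨E   : ∀ {Γ Δ φ ψ χ} → Γ ∣ Δ ⊢ φ ∨' ψ →
           Γ ∣ φ ∷ Δ ⊢ χ → Γ ∣ ψ ∷ Δ ⊢ χ → Γ ∣ Δ ⊢ χ
  ⇒I   : ∀ {Γ Δ φ ψ} → Γ ∣ φ ∷ Δ ⊢ ψ → Γ ∣ Δ ⊢ φ ⇒ ψ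
  ⇒E   : ∀ {Γ Δ φ ψ} → Γ ∣ Δ ⊢ φ ⇒ ψ → Γ ∣ Δ ⊢ φ → Γ ∣ Δ ⊢ ψ
  ∀I   : ∀ {Γ Δ s φ} → (Γ ▷ s) ∣ map wk Δ ⊢ φ → Γ ∣ Δ ⊢ ∀' s φ
  ∀E   : ∀ {Γ Δ s φ} → Γ ∣ Δ ⊢ ∀' s φ → (t : Tm Γ s) → Γ ∣ Δ ⊢ φ [ t ]
  ∃I   : ∀ {Γ Δ s φ} → (t : Tm Γ s) → Γ ∣ Δ ⊢ φ [ t ] → Γ ∣ Δ ⊢ ∃' s φ
  ∃E   : ∀ {Γ Δ s φ χ} → Γ ∣ Δ ⊢ ∃' s φ →
           (Γ ▷ s) ∣ φ ∷ map wk Δ ⊢ wk χ → Γ ∣ Δ ⊢ χ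
  ≐refl  : ∀ {Γ Δ} (t : Tm Γ num) → Γ ∣ Δ ⊢ t ≐ t
  ≐subst : ∀ {Γ Δ} (φ : Fm (Γ ▷ num)) {t u : Tm Γ num} →
           Γ ∣ Δ ⊢ t ≐ u → Γ ∣ Δ ⊢ φ [ t ] → Γ ∣ Δ ⊢ φ [ u ]

-- φ(Y) in the context Γ, X, Y
atY : ∀ {Γ} → Fm (Γ ▷ set) → Fm (Γ ▷ set ▷ set)
atY = renFm (liftR there)

BoundedOmni≺ : ∀ {Γ} → Fm (Γ ▷ set) → Fm (Γ ▷ set) → Fm Γ
BoundedOmni≺ φ ψ =
  ∀' set (∀' set ((v0 ≺ v1) ⇒ (atY φ ∨' atY ψ)) ⇒
          (∀' set ((v0 ≺ v1) ⇒ atY φ) ∨' ∃' set ((v0 ≺ v1) ∧' atY ψ)))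

BoundedOmni⪯ : ∀ {Γ} → Fm (Γ ▷ set) → Fm (Γ ▷ set) → Fm Γ
BoundedOmni⪯ φ ψ =
  ∀' set (∀' set ((v0 ⪯ v1) ⇒ (atY φ ∨' atY ψ)) ⇒
          (∀' set ((v0 ⪯ v1) ⇒ atY φ) ∨' ∃' set ((v0 ⪯ v1) ∧' atY ψ)))

{-# OPTIONS --safe #-}
module Submission where

-- By (W3) there is a Z whose components (Z)ₙ enumerate the sets Y ≺ X, and
-- each component exists as a set by decidable comprehension, membership in
-- (Z)ₙ being decidable by numerical omniscience. Since Y ≺ X is decidable, the
-- hypothesis yields, for every n, either ((Z)ₙ ≺ X → φ((Z)ₙ)) or
-- ((Z)ₙ ≺ X ∧ ψ((Z)ₙ)); numerical omniscience over n gives the disjunction, and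
-- because every formula respects set equality the first alternative becomes
-- ∀Y ≺ X φ(Y). For ⪯ one applies this to the strict part of the hypothesis and
-- settles the remaining instance Y = X directly.

open import Defs
open import Data.List using (List; []; _∷_; map)
open import Data.Product using (_×_; _,_)
open import Relation.Binary.PropositionalEquality
  using (_≡_; _≢_; refl; sym; cong; cong₂; subst)

private variable
  Γ Δ Θ : Ctx
  s s′ : Sort
  Hs : List (Fm Θ)

liftR-fuse : {ρ : Ren Δ Θ} {ρ′ : Ren Γ Δ} {k : Ren Γ Θ} →
  (∀ {s} (x : Γ ∋ s) → ρ (ρ′ x) ≡ k x) →
  ∀ {t s} (x : (Γ ▷ t) ∋ s) → liftR ρ (liftR ρ′ x) ≡ liftR k x
liftR-fuse e here      = refl
liftR-fuse e (there x) = cong there (e x)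

renTm-fuse : {ρ : Ren Δ Θ} {ρ′ : Ren Γ Δ} {k : Ren Γ Θ} →
  (∀ {s} (x : Γ ∋ s) → ρ (ρ′ x) ≡ k x) →
  (t : Tm Γ s) → renTm ρ (renTm ρ′ t) ≡ renTm k t
renTm-fuse e (var x)  = cong var (e x)
renTm-fuse e `0       = refl
renTm-fuse e (`S t)   = cong `S (renTm-fuse e t)
renTm-fuse e (t `+ u) = cong₂ _`+_ (renTm-fuse e t) (renTm-fuse e u)
renTm-fuse e (t `· u) = cong₂ _`·_ (renTm-fuse e t) (renTm-fuse e u)

renFm-fuse : {ρ : Ren Δ Θ} {ρ′ : Ren Γ Δ} {k : Ren Γ Θ} →
  (∀ {s} (x : Γ ∋ s) → ρ (ρ′ x) ≡ k x) →
  (F : Fm Γ) → renFm ρ (renFm ρ′ F) ≡ renFm k F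
renFm-fuse e ⊥'       = refl
renFm-fuse e (F ∧' G) = cong₂ _∧'_ (renFm-fuse e F) (renFm-fuse e G)
renFm-fuse e (F ∨' G) = cong₂ _∨'_ (renFm-fuse e F) (renFm-fuse e G)
renFm-fuse e (F ⇒ G)  = cong₂ _⇒_ (renFm-fuse e F) (renFm-fuse e G)
renFm-fuse e (∀' s F) = cong (∀' s) (renFm-fuse (liftR-fuse e) F)
renFm-fuse e (∃' s F) = cong (∃' s) (renFm-fuse (liftR-fuse e) F)
renFm-fuse e (t ≐ u)  = cong₂ _≐_ (renTm-fuse e t) (renTm-fuse e u)
renFm-fuse e (t ∈₁ u) = cong₂ _∈₁_ (renTm-fuse e t) (renTm-fuse e u)
renFm-fuse e (t ∈₂ u) = cong₂ _∈₂_ (renTm-fuse e t) (renTm-fuse e u)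
renFm-fuse e (t ≺ u)  = cong₂ _≺_ (renTm-fuse e t) (renTm-fuse e u)

renFm-∘ : (ρ : Ren Δ Θ) (ρ′ : Ren Γ Δ) (F : Fm Γ) →
  renFm ρ (renFm ρ′ F) ≡ renFm (λ x → ρ (ρ′ x)) F
renFm-∘ ρ ρ′ = renFm-fuse λ _ → refl

liftS-vanishes : {σ : Sub Δ Γ} {ρ : Ren Γ Δ} →
  (∀ {s} (x : Γ ∋ s) → σ (ρ x) ≡ var x) →
  ∀ {t s} (x : (Γ ▷ t) ∋ s) → liftS σ (liftR ρ x) ≡ var x
liftS-vanishes e here      = refl
liftS-vanishes e (there x) = cong (renTm there) (e x)

subTm-renTm-vanishes : {σ : Sub Δ Γ} {ρ : Ren Γ Δ} →
  (∀ {s} (x : Γ ∋ s) → σ (ρ x) ≡ var x) →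
  (t : Tm Γ s) → subTm σ (renTm ρ t) ≡ t
subTm-renTm-vanishes e (var x)  = e x
subTm-renTm-vanishes e `0       = refl
subTm-renTm-vanishes e (`S t)   = cong `S (subTm-renTm-vanishes e t)
subTm-renTm-vanishes e (t `+ u) = cong₂ _`+_ (subTm-renTm-vanishes e t) (subTm-renTm-vanishes e u)
subTm-renTm-vanishes e (t `· u) = cong₂ _`·_ (subTm-renTm-vanishes e t) (subTm-renTm-vanishes e u)

subFm-renFm-vanishes : {σ : Sub Δ Γ} {ρ : Ren Γ Δ} →
  (∀ {s} (x : Γ ∋ s) → σ (ρ x) ≡ var x) →
  (F : Fm Γ) → subFm σ (renFm ρ F) ≡ F
subFm-renFm-vanishes e ⊥'       = refl
subFm-renFm-vanishes e (F ∧' G) = cong₂ _∧'_ (subFm-renFm-vanishes e F) (subFm-renFm-vanishes e G)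
subFm-renFm-vanishes e (F ∨' G) = cong₂ _∨'_ (subFm-renFm-vanishes e F) (subFm-renFm-vanishes e G)
subFm-renFm-vanishes e (F ⇒ G)  = cong₂ _⇒_ (subFm-renFm-vanishes e F) (subFm-renFm-vanishes e G)
subFm-renFm-vanishes e (∀' s F) = cong (∀' s) (subFm-renFm-vanishes (liftS-vanishes e) F)
subFm-renFm-vanishes e (∃' s F) = cong (∃' s) (subFm-renFm-vanishes (liftS-vanishes e) F)
subFm-renFm-vanishes e (t ≐ u)  = cong₂ _≐_ (subTm-renTm-vanishes e t) (subTm-renTm-vanishes e u)
subFm-renFm-vanishes e (t ∈₁ u) = cong₂ _∈₁_ (subTm-renTm-vanishes e t) (subTm-renTm-vanishes e u)
subFm-renFm-vanishes e (t ∈₂ u) = cong₂ _∈₂_ (subTm-renTm-vanishes e t) (subTm-renTm-vanishes e u)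
subFm-renFm-vanishes e (t ≺ u)  = cong₂ _≺_ (subTm-renTm-vanishes e t) (subTm-renTm-vanishes e u)

liftWk-single-vanishes : (F : Fm (Θ ▷ s)) → subFm (single v0) (renFm (liftR there) F) ≡ F
liftWk-single-vanishes = subFm-renFm-vanishes λ { here → refl ; (there _) → refl }

cast : {F G : Fm Θ} → F ≡ G → Θ ∣ Hs ⊢ F → Θ ∣ Hs ⊢ G
cast {Θ = Θ} {Hs = Hs} = subst (Θ ∣ Hs ⊢_)

∀E-last : {F : Fm (Θ ▷ s)} → Θ ▷ s ∣ Hs ⊢ wk (∀' s F) → Θ ▷ s ∣ Hs ⊢ F
∀E-last {F = F} d = cast (liftWk-single-vanishes F) (∀E d v0)

∃I-last : {F : Fm (Θ ▷ s)} → Θ ▷ s ∣ Hs ⊢ F → Θ ▷ s ∣ Hs ⊢ wk (∃' s F)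
∃I-last {F = F} d = ∃I v0 (cast (sym (liftWk-single-vanishes F)) d)

∨-swap : {A B : Fm Θ} → Θ ∣ Hs ⊢ A ∨' B → Θ ∣ Hs ⊢ B ∨' A
∨-swap d = ∨E d (∨I₂ (hyp hd)) (∨I₁ (hyp hd))

decidable-guard : {D A B : Fm Θ} →
  Θ ∣ Hs ⊢ (D ∨' ¬' D) ⇒ (D ⇒ (A ∨' B)) ⇒ ((D ⇒ A) ∨' (D ∧' B))
decidable-guard = ⇒I (⇒I (∨E (hyp (tl hd))
  (∨E (⇒E (hyp (tl hd)) (hyp hd))
    (∨I₁ (⇒I (hyp (tl hd))))
    (∨I₂ (∧I (hyp (tl hd)) (hyp hd))))
  (∨I₁ (⇒I (⊥E (⇒E (hyp (tl hd)) (hyp hd)))))))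

∧-dec : {A B : Fm Θ} →
  Θ ∣ Hs ⊢ (A ∨' ¬' A) ⇒ (B ∨' ¬' B) ⇒ ((A ∧' B) ∨' ¬' (A ∧' B))
∧-dec = ⇒I (⇒I (∨E (hyp (tl hd))
  (∨E (hyp (tl hd))
    (∨I₁ (∧I (hyp (tl hd)) (hyp hd)))
    (∨I₂ (⇒I (⇒E (hyp (tl hd)) (∧E₂ (hyp hd))))))
  (∨I₂ (⇒I (⇒E (hyp (tl hd)) (∧E₁ (hyp hd)))))))

∃-dec : {F : Fm (Θ ▷ num)} →
  Θ ∣ Hs ⊢ ∀' num (F ∨' ¬' F) ⇒ (∃' num F ∨' ¬' (∃' num F))
∃-dec {F = F} = ⇒I (∨E (⇒E (ax (omniscience (¬' F) F)) (∀I (∨-swap (∀E-last (hyp hd)))))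
  (∨I₂ (⇒I (∃E (hyp hd) (⇒E (∀E-last (hyp (tl (tl hd)))) (hyp hd)))))
  (∨I₁ (hyp hd)))

≐-dec : (l r : Tm Θ num) → Θ ∣ Hs ⊢ (l ≐ r) ∨' ¬' (l ≐ r)
≐-dec l r = cast (cong (λ l′ → (l′ ≐ r) ∨' ¬' (l′ ≐ r)) (subTm-renTm-vanishes (λ _ → refl) l))
  (∀E (∀E (ax dec-≐) l) r)

≡ˢ-refl : (A : Tm Θ set) → Θ ∣ Hs ⊢ A ≡ˢ A
≡ˢ-refl A = ∀I (∧I (⇒I (hyp hd)) (⇒I (hyp hd)))

≡ˢ-sym : {a b : Θ ∋ set} → Θ ∣ Hs ⊢ (var a ≡ˢ var b) ⇒ (var b ≡ˢ var a)
≡ˢ-sym = ⇒I (∀I (∧I (∧E₂ (∀E (hyp hd) v0)) (∧E₁ (∀E (hyp hd) v0))))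

∈₁-resp-≡ˢ : {a b : Θ ∋ set} (t : Tm Θ num) →
  Θ ∣ Hs ⊢ var a ≡ˢ var b → Θ ∣ Hs ⊢ (t ∈₁ var a) ⇒ (t ∈₁ var b)
∈₁-resp-≡ˢ t a≡b = ∧E₁ (∀E a≡b t)

∈₂-resp-≡ˢ : {a b : Θ ∋ set} (c : Θ ∋ cls) →
  Θ ∣ Hs ⊢ var a ≡ˢ var b → Θ ∣ Hs ⊢ (var a ∈₂ var c) ⇒ (var b ∈₂ var c)
∈₂-resp-≡ˢ {a = a} {b} c = ⇒E (∀E (∀E (∀E (ax ext-∈₂) (var a)) (var b)) (var c))

≺-respˡ-≡ˢ : {a b : Θ ∋ set} (c : Θ ∋ set) →
  Θ ∣ Hs ⊢ var a ≡ˢ var b → Θ ∣ Hs ⊢ (var a ≺ var c) ⇒ (var b ≺ var c)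
≺-respˡ-≡ˢ {a = a} {b} c a≡b = ∧E₁ (⇒E (∀E (∀E (∀E (ax ext-≺) (var a)) (var b)) (var c)) a≡b)

≺-respʳ-≡ˢ : {a b : Θ ∋ set} (c : Θ ∋ set) →
  Θ ∣ Hs ⊢ var a ≡ˢ var b → Θ ∣ Hs ⊢ (var c ≺ var a) ⇒ (var c ≺ var b)
≺-respʳ-≡ˢ {a = a} {b} c a≡b = ∧E₂ (⇒E (∀E (∀E (∀E (ax ext-≺) (var a)) (var b)) (var c)) a≡b)

-- Hypotheses rather than derivations of a ≡ˢ b, so that the relation survives the
-- weakening of hypotheses under ∀I and ∃E without a weakening theorem for derivations.
infix 4 _⊢_≈_
data _⊢_≈_ (Hs : List (Fm Θ)) : Θ ∋ s → Θ ∋ s → Set where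
  refl≈ : {x : Θ ∋ s} → Hs ⊢ x ≈ x
  hyp≈  : {a b : Θ ∋ set} → (var a ≡ˢ var b) ∈ʰ Hs → Hs ⊢ a ≈ b
  hyp≈⁻ : {a b : Θ ∋ set} → (var b ≡ˢ var a) ∈ʰ Hs → Hs ⊢ a ≈ b

≈-sym : {a b : Θ ∋ s} → Hs ⊢ a ≈ b → Hs ⊢ b ≈ a
≈-sym refl≈     = refl≈
≈-sym (hyp≈ m)  = hyp≈⁻ m
≈-sym (hyp≈⁻ m) = hyp≈ m

≈-mono : {Hs′ : List (Fm Θ)} {a b : Θ ∋ s} →
  (∀ {F} → F ∈ʰ Hs → F ∈ʰ Hs′) → Hs ⊢ a ≈ b → Hs′ ⊢ a ≈ b
≈-mono f refl≈     = refl≈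
≈-mono f (hyp≈ m)  = hyp≈ (f m)
≈-mono f (hyp≈⁻ m) = hyp≈⁻ (f m)

∈ʰ-wk : {F : Fm Θ} → F ∈ʰ Hs → wk {s = s} F ∈ʰ map wk Hs
∈ʰ-wk hd     = hd
∈ʰ-wk (tl m) = tl (∈ʰ-wk m)

≈-wk : {a b : Θ ∋ s} → Hs ⊢ a ≈ b → map (wk {s = s′}) Hs ⊢ there a ≈ there b
≈-wk refl≈     = refl≈
≈-wk (hyp≈ m)  = hyp≈ (∈ʰ-wk m)
≈-wk (hyp≈⁻ m) = hyp≈⁻ (∈ʰ-wk m)

≈⇒≡ : {a b : Θ ∋ s} → s ≢ set → Hs ⊢ a ≈ b → a ≡ b
≈⇒≡ s≢set refl≈     = refl
≈⇒≡ s≢set (hyp≈ _)  with () ← s≢set refl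
≈⇒≡ s≢set (hyp≈⁻ _) with () ← s≢set refl

≈⇒≡ˢ : {a b : Θ ∋ set} → Hs ⊢ a ≈ b → Θ ∣ Hs ⊢ var a ≡ˢ var b
≈⇒≡ˢ refl≈     = ≡ˢ-refl _
≈⇒≡ˢ (hyp≈ m)  = hyp m
≈⇒≡ˢ (hyp≈⁻ m) = ⇒E ≡ˢ-sym (hyp m)

infix 4 _⊢_≈ᴿ_
_⊢_≈ᴿ_ : List (Fm Θ) → Ren Δ Θ → Ren Δ Θ → Set
_⊢_≈ᴿ_ {Δ = Δ} Hs ρ ρ′ = ∀ {s} (x : Δ ∋ s) → Hs ⊢ ρ x ≈ ρ′ x

≈ᴿ-sym : {ρ ρ′ : Ren Δ Θ} → Hs ⊢ ρ ≈ᴿ ρ′ → Hs ⊢ ρ′ ≈ᴿ ρ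
≈ᴿ-sym r x = ≈-sym (r x)

≈ᴿ-mono : {Hs′ : List (Fm Θ)} {ρ ρ′ : Ren Δ Θ} →
  (∀ {F} → F ∈ʰ Hs → F ∈ʰ Hs′) → Hs ⊢ ρ ≈ᴿ ρ′ → Hs′ ⊢ ρ ≈ᴿ ρ′
≈ᴿ-mono f r x = ≈-mono f (r x)

≈ᴿ-lift : {ρ ρ′ : Ren Δ Θ} → Hs ⊢ ρ ≈ᴿ ρ′ → map (wk {s = s}) Hs ⊢ liftR ρ ≈ᴿ liftR ρ′
≈ᴿ-lift r here      = refl≈
≈ᴿ-lift r (there x) = ≈-wk (r x)

renTm-resp-≈ : {ρ ρ′ : Ren Δ Θ} → Hs ⊢ ρ ≈ᴿ ρ′ → (t : Tm Δ num) → renTm ρ t ≡ renTm ρ′ t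
renTm-resp-≈ r (var x)  = cong var (≈⇒≡ (λ ()) (r x))
renTm-resp-≈ r `0       = refl
renTm-resp-≈ r (`S t)   = cong `S (renTm-resp-≈ r t)
renTm-resp-≈ r (t `+ u) = cong₂ _`+_ (renTm-resp-≈ r t) (renTm-resp-≈ r u)
renTm-resp-≈ r (t `· u) = cong₂ _`·_ (renTm-resp-≈ r t) (renTm-resp-≈ r u)

renFm-resp-≈ : (F : Fm Δ) {ρ ρ′ : Ren Δ Θ} → Hs ⊢ ρ ≈ᴿ ρ′ → Θ ∣ Hs ⊢ renFm ρ F ⇒ renFm ρ′ F
renFm-resp-≈ ⊥' r = ⇒I (hyp hd)
renFm-resp-≈ (F ∧' G) r =
  ⇒I (∧I (⇒E (renFm-resp-≈ F r′) (∧E₁ (hyp hd))) (⇒E (renFm-resp-≈ G r′) (∧E₂ (hyp hd))))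
  where r′ = ≈ᴿ-mono tl r
renFm-resp-≈ (F ∨' G) r = ⇒I (∨E (hyp hd)
  (∨I₁ (⇒E (renFm-resp-≈ F (≈ᴿ-mono (λ m → tl (tl m)) r)) (hyp hd)))
  (∨I₂ (⇒E (renFm-resp-≈ G (≈ᴿ-mono (λ m → tl (tl m)) r)) (hyp hd))))
renFm-resp-≈ (F ⇒ G) r =
  ⇒I (⇒I (⇒E (renFm-resp-≈ G r′) (⇒E (hyp (tl hd)) (⇒E (renFm-resp-≈ F (≈ᴿ-sym r′)) (hyp hd)))))
  where r′ = ≈ᴿ-mono (λ m → tl (tl m)) r
renFm-resp-≈ (∀' s F) r = ⇒I (∀I (⇒E (renFm-resp-≈ F (≈ᴿ-lift (≈ᴿ-mono tl r))) (∀E-last (hyp hd))))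
renFm-resp-≈ (∃' s F) r =
  ⇒I (∃E (hyp hd) (∃I-last (⇒E (renFm-resp-≈ F (≈ᴿ-mono tl (≈ᴿ-lift (≈ᴿ-mono tl r)))) (hyp hd))))
renFm-resp-≈ (t ≐ u) r = ⇒I (cast (cong₂ _≐_ (renTm-resp-≈ r t) (renTm-resp-≈ r u)) (hyp hd))
renFm-resp-≈ (t ∈₁ var a) {ρ} r = ⇒I (⇒E (∈₁-resp-≡ˢ _ (≈⇒≡ˢ (≈-mono tl (r a))))
  (cast (cong (_∈₁ var (ρ a)) (renTm-resp-≈ r t)) (hyp hd)))
renFm-resp-≈ (var a ∈₂ var c) {ρ} r = ⇒I (⇒E (∈₂-resp-≡ˢ _ (≈⇒≡ˢ (≈-mono tl (r a))))
  (cast (cong (λ c′ → var (ρ a) ∈₂ var c′) (≈⇒≡ (λ ()) (r c))) (hyp hd)))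
renFm-resp-≈ (var a ≺ var b) r = ⇒I (⇒E (≺-respʳ-≡ˢ _ (≈⇒≡ˢ (≈-mono tl (r b))))
  (⇒E (≺-respˡ-≡ˢ _ (≈⇒≡ˢ (≈-mono tl (r a)))) (hyp hd)))

PairIn-dec : (m n : Tm Θ num) (z : Θ ∋ set) →
  Θ ∣ Hs ⊢ PairIn m n (var z) ∨' ¬' (PairIn m n (var z))
PairIn-dec m n z =
  ⇒E ∃-dec (∀I (⇒E (⇒E ∧-dec (≐-dec _ _)) (∀E (∀E (ax dec-∈₁) v0) (var (there z)))))

component-exists : (z : Θ ∋ set) (n : Θ ∋ num) →
  Θ ∣ Hs ⊢ ∃' set (IsComp v0 (var (there z)) (var (there n)))
component-exists z n =
  ⇒E (ax (comp₂ (PairIn (var (there n)) v0 (var (there z))))) (∀I (PairIn-dec _ _ _))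

components-≡ˢ : {a b z : Θ ∋ set} {n : Θ ∋ num} →
  Θ ∣ Hs ⊢ IsComp (var a) (var z) (var n) ⇒ IsComp (var b) (var z) (var n) ⇒ (var a ≡ˢ var b)
components-≡ˢ = ⇒I (⇒I (∀I (∧I
  (⇒I (⇒E (∧E₂ (∀E (hyp (tl hd)) v0)) (⇒E (∧E₁ (∀E (hyp (tl (tl hd))) v0)) (hyp hd))))
  (⇒I (⇒E (∧E₂ (∀E (hyp (tl (tl hd))) v0)) (⇒E (∧E₁ (∀E (hyp (tl hd)) v0)) (hyp hd)))))))

AtComponent : Θ ∋ set → Fm (Θ ▷ set) → Fm (Θ ▷ num)
AtComponent z F = ∃' set (IsComp v0 (var (there (there z))) v1 ∧' renFm (liftR there) F)

-- ∀Y ≺ x ∃n Y = (z)ₙ, the conclusion of (W3).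
Enumerates : Θ ∋ set → Θ ∋ set → Fm Θ
Enumerates z x = ∀' set ((v0 ≺ var (there x)) ⇒ ∃' num (IsComp v1 (var (there (there z))) v0))

component-omniscience : (z : Θ ∋ set) (F G : Fm (Θ ▷ set)) →
  Θ ∣ Hs ⊢ ∀' set (F ∨' G) ⇒ (∀' num (AtComponent z F) ∨' ∃' set G)
component-omniscience {Θ = Θ} {Hs = Hs} z F G =
  ⇒I (∨E (⇒E (ax (omniscience (AtComponent z F) (AtComponent z G))) eachComponent)
    (∨I₁ (hyp hd))
    (∨I₂ (∃E (hyp hd) (∃E (hyp hd) (∃I-last (∧E₂ (hyp hd)))))))
  where
  eachComponent : Θ ∣ ∀' set (F ∨' G) ∷ Hs ⊢ ∀' num (AtComponent z F ∨' AtComponent z G)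
  eachComponent = ∀I (∃E (component-exists (there z) here) (∨E (∀E (hyp (tl hd)) v0)
    (∨I₁ (∃I v0 (∧I (hyp (tl hd)) (hyp hd))))
    (∨I₂ (∃I v0 (∧I (hyp (tl hd)) (hyp hd))))))

-- Y ≺ x is some (z)ₙ, and F passes from the witness W = (z)ₙ to Y since W ≡ˢ Y.
below-from-components : (z x : Θ ∋ set) (F : Fm (Θ ▷ set)) →
  Θ ∣ Hs ⊢ Enumerates z x ⇒ ∀' num (AtComponent z ((v0 ≺ var (there x)) ⇒ F))
                          ⇒ ∀' set ((v0 ≺ var (there x)) ⇒ F)
below-from-components {Θ = Θ} z x F = ⇒I (⇒I (∀I (⇒I
  (∃E (⇒E (∀E-last (hyp (tl (tl hd)))) (hyp hd))
    (∃E (∀E-last (hyp (tl (tl hd))))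
      (⇒E (⇒I transport) (⇒E (⇒E components-≡ˢ (∧E₁ (hyp hd))) (hyp (tl hd)))))))))
  where
  G : Fm (Θ ▷ set)
  G = (v0 ≺ var (there x)) ⇒ F
  transport : Θ ▷ set ▷ num ▷ set ∣ (v0 ≡ˢ v2) ∷ _ ⊢ renFm there (renFm there F)
  transport = cast (sym (renFm-∘ there there F))
    (⇒E (⇒E (renFm-resp-≈ G (λ { here → hyp≈ hd ; (there _) → refl≈ }))
            (cast (renFm-∘ (liftR (liftR there)) (liftR there) G) (∧E₂ (hyp (tl hd)))))
        (hyp (tl (tl (tl hd)))))

bounded-omniscience-below : (x : Θ ∋ set) (A B : Fm (Θ ▷ set)) →
  Θ ∣ Hs ⊢ ∀' set ((v0 ≺ var (there x)) ⇒ (A ∨' B))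
         ⇒ (∀' set ((v0 ≺ var (there x)) ⇒ A) ∨' ∃' set ((v0 ≺ var (there x)) ∧' B))
bounded-omniscience-below {Θ = Θ} x A B = ⇒I (∃E (∀E (ax w3) (var x))
  (∨E (⇒E (component-omniscience here _ _) guarded)
    (∨I₁ (⇒E (⇒E (below-from-components here (there x) _) (hyp (tl hd))) (hyp hd)))
    (∨I₂ (hyp hd))))
  where
  x↑ : Tm (Θ ▷ set ▷ set) set
  x↑ = var (there (there x))
  guarded : Θ ▷ set ∣ _ ⊢ ∀' set (((v0 ≺ x↑) ⇒ renFm (liftR there) A)
                                 ∨' ((v0 ≺ x↑) ∧' renFm (liftR there) B))
  guarded = ∀I (⇒E (⇒E decidable-guard (∀E (∀E (ax dec-≺) v0) x↑)) (∀E-last (hyp (tl hd))))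

bounded-omniscience≺ : (φ ψ : Fm (Γ ▷ set)) → Γ ∣ Hs ⊢ BoundedOmni≺ φ ψ
bounded-omniscience≺ φ ψ = ∀I (bounded-omniscience-below here (atY φ) (atY ψ))

bounded-omniscience⪯ : (φ ψ : Fm (Γ ▷ set)) → Γ ∣ Hs ⊢ BoundedOmni⪯ φ ψ
bounded-omniscience⪯ {Γ = Γ} φ ψ =
  ∀I (⇒I (∨E (⇒E (bounded-omniscience-below here (atY φ) (atY ψ)) strictly) allBelow someBelow))
  where
  strictly : Γ ▷ set ∣ _ ⊢ ∀' set ((v0 ≺ v1) ⇒ (atY φ ∨' atY ψ))
  strictly = ∀I (⇒I (⇒E (∀E-last (hyp (tl hd))) (∨I₁ (hyp hd))))
  someBelow : Γ ▷ set ∣ ∃' set ((v0 ≺ v1) ∧' atY ψ) ∷ _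
            ⊢ ∀' set ((v0 ⪯ v1) ⇒ atY φ) ∨' ∃' set ((v0 ⪯ v1) ∧' atY ψ)
  someBelow = ∨I₂ (∃E (hyp hd) (∃I-last (∧I (∨I₁ (∧E₁ (hyp hd))) (∧E₂ (hyp hd)))))
  allBelow : Γ ▷ set ∣ ∀' set ((v0 ≺ v1) ⇒ atY φ) ∷ _
           ⊢ ∀' set ((v0 ⪯ v1) ⇒ atY φ) ∨' ∃' set ((v0 ⪯ v1) ∧' atY ψ)
  allBelow = ∨E (⇒E (∀E (hyp (tl hd)) v0) (∨I₂ (≡ˢ-refl v0)))
    (∨I₁ (∀I (⇒I (∨E (hyp hd)
      (⇒E (∀E-last (hyp (tl (tl (tl hd))))) (hyp hd))
      (⇒E (renFm-resp-≈ φ (λ { here → hyp≈⁻ hd ; (there _) → refl≈ }))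
          (cast (cong wk (liftWk-single-vanishes φ)) (hyp (tl (tl hd)))))))))
    (∨I₂ (∃I v0 (∧I (∨I₂ (≡ˢ-refl v0)) (hyp hd))))

mainTheorem7 : ∀ {Γ : Ctx} (φ ψ : Fm (Γ ▷ set)) →
    (Γ ∣ [] ⊢ BoundedOmni≺ φ ψ) × (Γ ∣ [] ⊢ BoundedOmni⪯ φ ψ)
mainTheorem7 φ ψ = bounded-omniscience≺ φ ψ , bounded-omniscience⪯ φ ψ
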